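{- For any graph $G$ of order $n$ and any positive integer $t$, $\beta(S(G,t))=n^{t-1}\beta(G)$, where $\beta$ denotes the vertex cover number.
   Context: A vertex cover of a graph is a set of vertices meeting every edge; the vertex cover number $\beta(G)$ is the minimum cardinality of a vertex cover of $G$. For a graph $G=(V,E)$ and a positive integer $t$, $V^t$ denotes the set of words $u=u_1u_2\cdots u_t$ of length $t$ over the alphabet $V$. The generalized Sierpiński graph $S(G,t)$ has vertex set $V^t$, and $\{u,v\}$ is an edge if and only if there is $i\in\{1,\dots,t\}$ such that: (i) $u_j=v_j$ for all $j<i$; (ii) $u_i\ne v_i$ and $\{u_i,v_i\}\in E$; (iii) $u_j=v_i$ and $v_j=u_i$ for all $j>i$. -}

module Defs where

open import Level using (0ℓ)
open import Data.Nat using (ℕ; _≤_; _<_)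
open import Data.Fin using (Fin; toℕ)
open import Data.Vec using (Vec; lookup)
open import Data.List using (List; length)
open import Data.List.Membership.Propositional using (_∈_)
open import Data.List.Relation.Unary.Unique.Propositional using (Unique)
open import Data.Product using (Σ; _×_; ∃)
open import Data.Sum using (_⊎_)
open import Relation.Nullary using (¬_)
open import Relation.Binary.PropositionalEquality using (_≡_)

record Graph (n : ℕ) : Set₁ where
  field
    Adj   : Fin n → Fin n → Set
    sym   : ∀ {x y} → Adj x y → Adj y x
    irrefl : ∀ {x} → ¬ Adj x x

-- Vertex covers for an arbitrary vertex type with an edge relation:
-- a duplicate-free list of vertices meeting every edge; its size is its length.
IsVertexCover : {V : Set} → (V → V → Set) → List V → Set
IsVertexCover {V} E C = Unique C × (∀ (x y : V) → E x y → (x ∈ C) ⊎ (y ∈ C))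

IsVertexCoverNumber : {V : Set} → (V → V → Set) → ℕ → Set
IsVertexCoverNumber {V} E k =
  (Σ (List V) λ C → IsVertexCover E C × length C ≡ k)
  × (∀ (C : List V) → IsVertexCover E C → k ≤ length C)

-- Adjacency in the generalized Sierpiński graph S(G,t): vertices are words
-- u = u_1 ... u_t ∈ (Fin n)^t (positions indexed by Fin t).
SierpinskiAdj : ∀ {n} → Graph n → (t : ℕ) → Vec (Fin n) t → Vec (Fin n) t → Set
SierpinskiAdj G t u v =
  Σ (Fin t) λ i →
    (∀ (j : Fin t) → toℕ j < toℕ i → lookup u j ≡ lookup v j)
    × ¬ (lookup u i ≡ lookup v i)
    × Graph.Adj G (lookup u i) (lookup v i)
    × (∀ (j : Fin t) → toℕ i < toℕ j → (lookup u j ≡ lookup v i) × (lookup v j ≡ lookup u i))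

module Submission where

-- Upper bound.  Every edge of S(G,t+1) joins two words whose LAST letters
-- are adjacent in G (`last-letters-adjacent`).  So if C is a vertex cover of
-- G, the nᵗ·|C| words whose last letter lies in C (`endingIn C t`) cover
-- S(G,t+1).
--
-- Lower bound, by induction on t (`lower-bound`).  S(G,1) is a copy of G.
-- For every letter a, the words beginning with a induce a copy of S(G,t+1)
-- inside S(G,t+2) (`prefix-adjacent`), so a cover D of S(G,t+2) restricts to
-- n covers `restrict a D` of S(G,t+1).  These pieces sit disjointly inside D,
-- whence |D| ≥ n · nᵗβ(G).

open import Defs
open import Data.Nat using (ℕ; zero; suc; _*_; _^_; _+_; _≤_; _<_; z≤n; s≤s)
open import Data.Nat.Properties
  using (+-mono-≤; *-assoc; +-identityʳ; module ≤-Reasoning)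
open import Data.Fin using (Fin; zero; suc; toℕ; fromℕ; _≟_)
open import Data.Fin.Properties using (≤fromℕ; ≤∧≢⇒<)
open import Data.Vec using (Vec; []; _∷_; head; lookup)
open import Data.Vec.Properties using (∷-injective; ∷-injectiveˡ; ∷-injectiveʳ)
open import Data.List using (List; []; _∷_; _++_; map; length; allFin)
open import Data.List.Properties using (length-map; length-++; length-tabulate; length-removeAt′)
open import Data.List.Membership.Propositional using (_∈_)
open import Data.List.Membership.Propositional.Properties
  using (∈-allFin; ∈-map⁺; ∈-map⁻; ∈-++⁺ˡ; ∈-++⁺ʳ; ∈-++⁻)
open import Data.List.Relation.Unary.Any using (here; there; _─_)
import Data.List.Relation.Unary.All as All
open import Data.List.Relation.Unary.AllPairs using ([]; _∷_)
open import Data.List.Relation.Unary.Unique.Propositional using (Unique)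
import Data.List.Relation.Unary.Unique.Propositional.Properties as Unique
open import Data.List.Relation.Binary.Subset.Propositional using (_⊆_)
open import Data.Product using (_×_; _,_; proj₁; proj₂)
open import Data.Sum using (_⊎_; inj₁; inj₂; [_,_]′)
open import Data.Empty using (⊥)
open import Relation.Nullary using (yes; no; contradiction)
open import Relation.Binary.Definitions using (DecidableEquality)
open import Relation.Binary.PropositionalEquality
  using (_≡_; _≢_; refl; sym; trans; cong; subst; subst₂; module ≡-Reasoning)

CoverLowerBound : {V : Set} → (V → V → Set) → ℕ → Set
CoverLowerBound {V} E k = ∀ (C : List V) → IsVertexCover E C → k ≤ length C

module _ {A : Set} where

  ∈-─ : ∀ {x z : A} (ys : List A) (x∈ys : x ∈ ys) → z ∈ ys → z ≢ x → z ∈ (ys ─ x∈ys)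
  ∈-─ (y ∷ ys) (here refl)  (here refl) z≢x = contradiction refl z≢x
  ∈-─ (y ∷ ys) (here refl)  (there z∈ys) _   = z∈ys
  ∈-─ (y ∷ ys) (there x∈ys) (here refl)  _   = here refl
  ∈-─ (y ∷ ys) (there x∈ys) (there z∈ys) z≢x = there (∈-─ ys x∈ys z∈ys z≢x)

  unique-⊆⇒length≤ : ∀ (xs ys : List A) → Unique xs → xs ⊆ ys → length xs ≤ length ys
  unique-⊆⇒length≤ []       ys _              _    = z≤n
  unique-⊆⇒length≤ (x ∷ xs) ys (x∉xs ∷ xs!) xs⊆ys =
    subst (suc (length xs) ≤_) (sym (length-removeAt′ ys _))
      (s≤s (unique-⊆⇒length≤ xs (ys ─ x∈ys) xs! xs⊆ys─x))
    where
      x∈ys : x ∈ ys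
      x∈ys = xs⊆ys (here refl)
      xs⊆ys─x : xs ⊆ (ys ─ x∈ys)
      xs⊆ys─x z∈xs = ∈-─ ys x∈ys (xs⊆ys (there z∈xs)) (λ z≡x → All.lookup x∉xs z∈xs (sym z≡x))

module _ {A : Set} {m : ℕ} where

  prefixed : List A → (A → List (Vec A m)) → List (Vec A (suc m))
  prefixed []       F = []
  prefixed (a ∷ as) F = map (a ∷_) (F a) ++ prefixed as F

  ∈-map-∷⁻ : ∀ {a c w} (ws : List (Vec A m)) → (c ∷ w) ∈ map (a ∷_) ws → c ≡ a × w ∈ ws
  ∈-map-∷⁻ ws cw∈ with v , v∈ws , cw≡av ← ∈-map⁻ (_ ∷_) cw∈ with refl , refl ← ∷-injective cw≡av =
    refl , v∈ws

  ∈-prefixed⁺ : ∀ {a w} (as : List A) (F : A → List (Vec A m)) →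
                a ∈ as → w ∈ F a → (a ∷ w) ∈ prefixed as F
  ∈-prefixed⁺ (a ∷ as) F (here refl) w∈Fa = ∈-++⁺ˡ (∈-map⁺ (a ∷_) w∈Fa)
  ∈-prefixed⁺ (b ∷ as) F (there a∈as) w∈Fa =
    ∈-++⁺ʳ (map (b ∷_) (F b)) (∈-prefixed⁺ as F a∈as w∈Fa)

  ∈-prefixed⁻ : ∀ {c w} (as : List A) (F : A → List (Vec A m)) →
                (c ∷ w) ∈ prefixed as F → c ∈ as × w ∈ F c
  ∈-prefixed⁻ (a ∷ as) F cw∈ with ∈-++⁻ (map (a ∷_) (F a)) cw∈
  ... | inj₁ cw∈aFa with refl , w∈Fa ← ∈-map-∷⁻ (F a) cw∈aFa = here refl , w∈Fa
  ... | inj₂ cw∈rest = let c∈as , w∈Fc = ∈-prefixed⁻ as F cw∈rest in there c∈as , w∈Fc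

  prefixed-unique : (as : List A) (F : A → List (Vec A m)) →
                    Unique as → (∀ a → Unique (F a)) → Unique (prefixed as F)
  prefixed-unique []       F _            _   = []
  prefixed-unique (a ∷ as) F (a∉as ∷ as!) F! =
    Unique.++⁺ (Unique.map⁺ ∷-injectiveʳ (F! a)) (prefixed-unique as F as! F!) disjoint
    where
      disjoint : ∀ {v} → v ∈ map (a ∷_) (F a) × v ∈ prefixed as F → ⊥
      disjoint {c ∷ w} (v∈aFa , v∈rest) with refl , _ ← ∈-map-∷⁻ (F a) v∈aFa =
        All.lookup a∉as (proj₁ (∈-prefixed⁻ as F v∈rest)) refl

  length-prefixed : (as : List A) (F : A → List (Vec A m)) (k : ℕ) →
                    (∀ a → length (F a) ≡ k) → length (prefixed as F) ≡ length as * k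
  length-prefixed []       F k |F|≡k = refl
  length-prefixed (a ∷ as) F k |F|≡k = begin
    length (map (a ∷_) (F a) ++ prefixed as F)           ≡⟨ length-++ (map (a ∷_) (F a)) ⟩
    length (map (a ∷_) (F a)) + length (prefixed as F)   ≡⟨ cong (_+ _) (length-map (a ∷_) (F a)) ⟩
    length (F a) + length (prefixed as F)                ≡⟨ cong (_+ _) (|F|≡k a) ⟩
    k + length (prefixed as F)                           ≡⟨ cong (k +_) (length-prefixed as F k |F|≡k) ⟩
    k + length as * k                                    ∎
    where open ≡-Reasoning

  length-prefixed-≥ : (as : List A) (F : A → List (Vec A m)) (k : ℕ) →
                      (∀ a → k ≤ length (F a)) → length as * k ≤ length (prefixed as F)
  length-prefixed-≥ []       F k k≤|F| = z≤n
  length-prefixed-≥ (a ∷ as) F k k≤|F| = begin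
    k + length as * k                                    ≤⟨ +-mono-≤ (k≤|F| a) (length-prefixed-≥ as F k k≤|F|) ⟩
    length (F a) + length (prefixed as F)                ≡⟨ cong (_+ _) (length-map (a ∷_) (F a)) ⟨
    length (map (a ∷_) (F a)) + length (prefixed as F)   ≡⟨ length-++ (map (a ∷_) (F a)) ⟨
    length (map (a ∷_) (F a) ++ prefixed as F)           ∎
    where open ≤-Reasoning

module _ {A : Set} (_≟ᴬ_ : DecidableEquality A) {m : ℕ} where

  restrict : A → List (Vec A (suc m)) → List (Vec A m)
  restrict a []             = []
  restrict a ((c ∷ w) ∷ D) with c ≟ᴬ a
  ... | yes _ = w ∷ restrict a D
  ... | no  _ = restrict a D

  ∈-restrict⁺ : ∀ a (D : List (Vec A (suc m))) {w} → (a ∷ w) ∈ D → w ∈ restrict a D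
  ∈-restrict⁺ a ((c ∷ w) ∷ D) aw∈ with c ≟ᴬ a | aw∈
  ... | yes _   | here refl  = here refl
  ... | yes _   | there aw∈D = there (∈-restrict⁺ a D aw∈D)
  ... | no  c≢a | here refl  = contradiction refl c≢a
  ... | no  _   | there aw∈D = ∈-restrict⁺ a D aw∈D

  ∈-restrict⁻ : ∀ a (D : List (Vec A (suc m))) {w} → w ∈ restrict a D → (a ∷ w) ∈ D
  ∈-restrict⁻ a ((c ∷ w) ∷ D) w∈ with c ≟ᴬ a | w∈
  ... | yes refl | here refl = here refl
  ... | yes _    | there w∈  = there (∈-restrict⁻ a D w∈)
  ... | no  _    | w∈′       = there (∈-restrict⁻ a D w∈′)

  restrict-unique : ∀ a (D : List (Vec A (suc m))) → Unique D → Unique (restrict a D)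
  restrict-unique a []             _            = []
  restrict-unique a ((c ∷ w) ∷ D) (cw∉D ∷ D!) with c ≟ᴬ a
  ... | yes refl = All.tabulate (λ v∈ w≡v → All.lookup cw∉D (∈-restrict⁻ a D v∈) (cong (a ∷_) w≡v))
                   ∷ restrict-unique a D D!
  ... | no  _    = restrict-unique a D D!

  prefixed-restrict-⊆ : (as : List A) (D : List (Vec A (suc m))) → prefixed as (λ a → restrict a D) ⊆ D
  prefixed-restrict-⊆ as D {c ∷ w} cw∈ = ∈-restrict⁻ c D (proj₂ (∈-prefixed⁻ as _ cw∈))

length-allFin : ∀ n → length (allFin n) ≡ n
length-allFin n = length-tabulate (λ i → i)

module _ {n : ℕ} where

  endingIn : List (Fin n) → (t : ℕ) → List (Vec (Fin n) (suc t))
  endingIn C zero    = map (_∷ []) C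
  endingIn C (suc t) = prefixed (allFin n) (λ _ → endingIn C t)

  ∈-endingIn : ∀ C t (w : Vec (Fin n) (suc t)) → lookup w (fromℕ t) ∈ C → w ∈ endingIn C t
  ∈-endingIn C zero    (a ∷ []) a∈C = ∈-map⁺ (_∷ []) a∈C
  ∈-endingIn C (suc t) (a ∷ w)  w∈  = ∈-prefixed⁺ (allFin n) _ (∈-allFin a) (∈-endingIn C t w w∈)

  endingIn-unique : ∀ C t → Unique C → Unique (endingIn C t)
  endingIn-unique C zero    C! = Unique.map⁺ ∷-injectiveˡ C!
  endingIn-unique C (suc t) C! =
    prefixed-unique (allFin n) _ (Unique.allFin⁺ n) (λ _ → endingIn-unique C t C!)

  length-endingIn : ∀ C t → length (endingIn C t) ≡ n ^ t * length C
  length-endingIn C zero    = trans (length-map (_∷ []) C) (sym (+-identityʳ (length C)))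
  length-endingIn C (suc t) = begin
    length (prefixed (allFin n) (λ _ → endingIn C t)) ≡⟨ length-prefixed (allFin n) _ _ (λ _ → length-endingIn C t) ⟩
    length (allFin n) * (n ^ t * length C)            ≡⟨ cong (_* (n ^ t * length C)) (length-allFin n) ⟩
    n * (n ^ t * length C)                            ≡⟨ *-assoc n (n ^ t) (length C) ⟨
    n ^ suc t * length C                              ∎
    where open ≡-Reasoning

module _ {n : ℕ} (G : Graph n) where
  open Graph G using (Adj)

  -- In an edge of S(G,t+1) at position i, all later letters of u equal v_i
  -- and vice versa; so the last letters of the endpoints are adjacent in G.
  last-letters-adjacent : ∀ t (u v : Vec (Fin n) (suc t)) → SierpinskiAdj G (suc t) u v →
                          Adj (lookup u (fromℕ t)) (lookup v (fromℕ t))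
  last-letters-adjacent t u v (i , _ , _ , uᵢ~vᵢ , after-i) with i ≟ fromℕ t
  ... | yes refl = uᵢ~vᵢ
  ... | no  i≢last =
    let uₜ≡vᵢ , vₜ≡uᵢ = after-i (fromℕ t) (≤∧≢⇒< (≤fromℕ i) i≢last)
    in subst₂ Adj (sym uₜ≡vᵢ) (sym vₜ≡uᵢ) (Graph.sym G uᵢ~vᵢ)

  single-letter-adjacent : ∀ {x y} → Adj x y → SierpinskiAdj G 1 (x ∷ []) (y ∷ [])
  single-letter-adjacent {x} x~y =
    zero , (λ _ ()) , (λ x≡y → Graph.irrefl G (subst (Adj x) (sym x≡y) x~y)) , x~y , (λ { zero () })

  prefix-adjacent : ∀ t a (u v : Vec (Fin n) (suc t)) → SierpinskiAdj G (suc t) u v →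
                    SierpinskiAdj G (suc (suc t)) (a ∷ u) (a ∷ v)
  prefix-adjacent t a u v (i , before-i , uᵢ≢vᵢ , uᵢ~vᵢ , after-i) =
    suc i , before-suc-i , uᵢ≢vᵢ , uᵢ~vᵢ , after-suc-i
    where
      before-suc-i : ∀ j → toℕ j < toℕ (suc i) → lookup (a ∷ u) j ≡ lookup (a ∷ v) j
      before-suc-i zero    _         = refl
      before-suc-i (suc j) (s≤s j<i) = before-i j j<i
      after-suc-i : ∀ j → toℕ (suc i) < toℕ j →
                    lookup (a ∷ u) j ≡ lookup v i × lookup (a ∷ v) j ≡ lookup u i
      after-suc-i (suc j) (s≤s i<j) = after-i j i<j

  endingIn-cover : ∀ C t → IsVertexCover Adj C → IsVertexCover (SierpinskiAdj G (suc t)) (endingIn C t)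
  endingIn-cover C t (C! , C-covers) =
    endingIn-unique C t C! ,
    λ u v u~v → [ (λ uₜ∈C → inj₁ (∈-endingIn C t u uₜ∈C)) , (λ vₜ∈C → inj₂ (∈-endingIn C t v vₜ∈C)) ]′
                  (C-covers _ _ (last-letters-adjacent t u v u~v))

  single-letter-cover : ∀ (D : List (Vec (Fin n) 1)) →
                        IsVertexCover (SierpinskiAdj G 1) D → IsVertexCover Adj (map head D)
  single-letter-cover D (D! , D-covers) = Unique.map⁺ head-injective D! , covers
    where
      head-injective : ∀ {u v : Vec (Fin n) 1} → head u ≡ head v → u ≡ v
      head-injective {_ ∷ []} {_ ∷ []} refl = refl
      covers : ∀ x y → Adj x y → x ∈ map head D ⊎ y ∈ map head D
      covers x y x~y = [ (λ x∈D → inj₁ (∈-map⁺ head x∈D)) , (λ y∈D → inj₂ (∈-map⁺ head y∈D)) ]′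
                         (D-covers (x ∷ []) (y ∷ []) (single-letter-adjacent x~y))

  restrict-cover : ∀ t a (D : List (Vec (Fin n) (suc (suc t)))) →
                   IsVertexCover (SierpinskiAdj G (suc (suc t))) D →
                   IsVertexCover (SierpinskiAdj G (suc t)) (restrict _≟_ a D)
  restrict-cover t a D (D! , D-covers) =
    restrict-unique _≟_ a D D! ,
    λ u v u~v → [ (λ au∈D → inj₁ (∈-restrict⁺ _≟_ a D au∈D)) , (λ av∈D → inj₂ (∈-restrict⁺ _≟_ a D av∈D)) ]′
                  (D-covers _ _ (prefix-adjacent t a u v u~v))

  lower-bound : ∀ {b} → CoverLowerBound Adj b → ∀ t → CoverLowerBound (SierpinskiAdj G (suc t)) (n ^ t * b)
  lower-bound {b} b-min zero D D-cover = begin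
    b + 0               ≡⟨ +-identityʳ b ⟩
    b                   ≤⟨ b-min (map head D) (single-letter-cover D D-cover) ⟩
    length (map head D) ≡⟨ length-map head D ⟩
    length D            ∎
    where open ≤-Reasoning
  lower-bound {b} b-min (suc t) D D-cover@(D! , _) = begin
    n ^ suc t * b                    ≡⟨ *-assoc n (n ^ t) b ⟩
    n * (n ^ t * b)                  ≡⟨ cong (_* (n ^ t * b)) (length-allFin n) ⟨
    length (allFin n) * (n ^ t * b)  ≤⟨ length-prefixed-≥ (allFin n) pieces _ piece-large ⟩
    length (prefixed (allFin n) pieces)
      ≤⟨ unique-⊆⇒length≤ _ D pieces-unique (prefixed-restrict-⊆ _≟_ (allFin n) D) ⟩
    length D                         ∎
    where
      open ≤-Reasoning
      pieces : Fin n → List (Vec (Fin n) (suc t))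
      pieces a = restrict _≟_ a D
      piece-large : ∀ a → n ^ t * b ≤ length (pieces a)
      piece-large a = lower-bound b-min t (pieces a) (restrict-cover t a D D-cover)
      pieces-unique : Unique (prefixed (allFin n) pieces)
      pieces-unique = prefixed-unique (allFin n) pieces (Unique.allFin⁺ n) (λ a → restrict-unique _≟_ a D D!)

theorem8 : ∀ (n : ℕ) (G : Graph n) (t : ℕ) (b : ℕ) →
    IsVertexCoverNumber (Graph.Adj G) b →
    IsVertexCoverNumber (SierpinskiAdj G (suc t)) (n ^ t * b)
theorem8 n G t b ((C , C-cover , |C|≡b) , b-min) =
  (endingIn C t , endingIn-cover G C t C-cover , size) , lower-bound G b-min t
  where
    size : length (endingIn C t) ≡ n ^ t * b
    size = trans (length-endingIn C t) (cong (n ^ t *_) |C|≡b)
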